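{- Let $a,b,\ell$ be positive integers and let $V \in \mathrm{Inc}^\ell(a\times b)$ satisfy $\mathsf{Frame}(V) = \mathsf{Frame}(\Psi(V))$, where $\Psi$ is $K$-promotion on $\mathrm{Inc}^\ell(a\times b)$. Then $V$ is minimal and $\ell = a+b-1$.
   Context: $a\times b$ denotes the grid of boxes with $a$ rows and $b$ columns, boxes indexed as matrix entries $(i,j)$. An increasing tableau of shape $a\times b$ is a filling of the boxes by positive integers strictly increasing left to right along rows and top to bottom along columns; $\mathrm{Inc}^\ell(a\times b)$ is the set of such tableaux with all entries at most $\ell$. $K$-promotion $\Psi$ on $\mathrm{Inc}^\ell(a\times b)$: given $V$, for $j = 2,3,\dots,\ell$ in turn, consider the set of boxes currently labeled $1$ or $j$, split it into edge-connected components, and in each component with more than one box swap the labels $1$ and $j$ (single-box components are unchanged); afterwards decrease every label by $1$ and replace any resulting $0$ by $\ell$. The frame of the shape $a\times b$ is the set of boxes in the first or last row or the first or last column; for $U \in \mathrm{Inc}^\ell(a\times b)$, $\mathsf{Frame}(U)$ is the restriction of the filling $U$ to these boxes. A tableau $V \in \mathrm{Inc}(a\times b)$ is minimal if $V(1,1)=1$, $V(i,j+1)=V(i,j)+1$ whenever $j<b$, and $V(i+1,j)=V(i,j)+1$ whenever $i<a$ (i.e. $V(i,j)=i+j-1$). -}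

module Defs where

open import Data.Nat using (ℕ; zero; suc; _+_; _∸_; _≤_; _<_; _≡ᵇ_)
open import Data.Fin using (Fin; toℕ)
open import Data.Bool using (Bool; true; false; _∧_; _∨_; if_then_else_)
open import Data.Bool.ListAction using (any)
open import Data.List using (List; allFin; upTo; map; foldl; concatMap)
open import Data.Product using (_×_; _,_)
open import Data.Sum using (_⊎_)
open import Relation.Binary.PropositionalEquality using (_≡_)

Filling : ℕ → ℕ → Set
Filling a b = Fin a → Fin b → ℕ

IsIncreasing : ∀ {a b} → ℕ → Filling a b → Set
IsIncreasing {a} {b} ℓ V =
  (∀ i j → 1 ≤ V i j × V i j ≤ ℓ)
  × (∀ i j j′ → toℕ j < toℕ j′ → V i j < V i j′)
  × (∀ i i′ j → toℕ i < toℕ i′ → V i j < V i′ j)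

boxes : ∀ a b → List (Fin a × Fin b)
boxes a b = concatMap (λ i → map (λ j → (i , j)) (allFin b)) (allFin a)

adjacent : ∀ {a b} → Fin a × Fin b → Fin a × Fin b → Bool
adjacent (i , j) (i′ , j′) =
  ((toℕ i ≡ᵇ toℕ i′) ∧ ((suc (toℕ j) ≡ᵇ toℕ j′) ∨ (suc (toℕ j′) ≡ᵇ toℕ j)))
  ∨ ((toℕ j ≡ᵇ toℕ j′) ∧ ((suc (toℕ i) ≡ᵇ toℕ i′) ∨ (suc (toℕ i′) ≡ᵇ toℕ i)))

in1k : ℕ → ℕ → Bool
in1k k x = (x ≡ᵇ 1) ∨ (x ≡ᵇ k)

swap1k : ℕ → ℕ → ℕ
swap1k k x = if x ≡ᵇ 1 then k else (if x ≡ᵇ k then 1 else x)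

-- One step of K-promotion for label k: in every edge-connected component of
-- the set of boxes labelled 1 or k having more than one box, swap 1 and k.
-- A box of that set lies in a component with more than one box exactly when
-- it has an edge-neighbour in the set (components are connected).
kstep : ∀ {a b} → ℕ → Filling a b → Filling a b
kstep {a} {b} k V i j =
  if in1k k (V i j)
     ∧ any (λ q → adjacent (i , j) q ∧ in1k k (V (Data.Product.proj₁ q) (Data.Product.proj₂ q))) (boxes a b)
  then swap1k k (V i j)
  else V i j

decr : ℕ → ℕ → ℕ
decr ℓ zero = ℓ
decr ℓ (suc zero) = ℓ
decr ℓ (suc (suc n)) = suc n

Kpromotion : ∀ {a b} → ℕ → Filling a b → Filling a b
Kpromotion ℓ V i j =
  decr ℓ (foldl (λ W k → kstep k W) V (map (λ n → 2 + n) (upTo (ℓ ∸ 1))) i j)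

InFrame : ∀ {a b} → Fin a → Fin b → Set
InFrame {a} {b} i j =
  (toℕ i ≡ 0 ⊎ suc (toℕ i) ≡ a) ⊎ (toℕ j ≡ 0 ⊎ suc (toℕ j) ≡ b)

SameFrame : ∀ {a b} → Filling a b → Filling a b → Set
SameFrame {a} {b} U W = ∀ (i : Fin a) (j : Fin b) → InFrame i j → U i j ≡ W i j

-- V is minimal: V(i,j) = i + j - 1 in 1-based indexing.
IsMinimal : ∀ {a b} → Filling a b → Set
IsMinimal V = ∀ i j → V i j ≡ suc (toℕ i + toℕ j)

-- During K-promotion the boxes labelled 1 act as holes: at step k a hole next to a
-- box labelled k swaps with it, and holes are never adjacent.  If Ψ(V)(p) = V(p),
-- then p was a hole right after step V(p) and, unless V(p) = ℓ, it was refilled at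
-- step V(p) + 1 from a neighbour labelled V(p) + 1.  In the first row a new hole can
-- only come from the left neighbour q, which lies in the frame as well and so is a
-- hole only right after step V(q); hence V(p) = V(q) + 1.  In the last column the
-- refill can only come from the box below, so again the labels go up by one, and
-- the corner cannot be refilled at all, so it carries ℓ.  Thus V(1,1) = 1 and
-- V(a,b) = ℓ = a + b - 1, which squeezes every entry of V to its minimal value.
module Submission where

open import Defs
open import Data.Nat using (ℕ; _+_; _∸_; _≤_)
open import Data.Product using (_×_)
open import Relation.Binary.PropositionalEquality using (_≡_)

open import Data.Bool using (Bool; true; false; T; _∧_; if_then_else_)
open import Data.Bool.Properties using (T-∨; T-∧; T-≡)
open import Data.Bool.ListAction using (any)
open import Data.Empty using (⊥; ⊥-elim)
open import Data.Fin using (Fin; zero; suc; toℕ; inject₁; fromℕ)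
open import Data.Fin.Properties using (toℕ-injective; toℕ-inject₁; toℕ-fromℕ; toℕ<n)
open import Data.List using (allFin; map; foldl; upTo; _∷ʳ_)
open import Data.List.Membership.Propositional using (_∈_; lose)
open import Data.List.Membership.Propositional.Properties using (∈-map⁺; ∈-concatMap⁺; ∈-allFin)
open import Data.List.Properties using (foldl-map; foldl-∷ʳ; upTo-∷ʳ)
open import Data.List.Relation.Unary.Any using (satisfied)
open import Data.List.Relation.Unary.Any.Properties using (any⁺; any⁻)
open import Data.Nat
  using (zero; suc; _<_; _≡ᵇ_; z≤n; s≤s; s≤s⁻¹; s<s⁻¹; _≤′_; ≤′-refl; ≤′-step)
open import Data.Nat.Properties
  using ( ≡ᵇ⇒≡; ≡⇒≡ᵇ; suc-injective; 0≢1+n; 1+n≢n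
        ; ≤-refl; ≤-reflexive; ≤-trans; ≤-antisym; <-irrefl; <-asym; <-≤-trans
        ; <⇒≤; <⇒≢; >⇒≢; <⇒≱
        ; n≤1+n; m≤n⇒m≤1+n; m≤n⇒m<n∨m≡n; m≤n⇒∃[o]m+o≡n; ≤′⇒≤; ≤⇒≤′
        ; +-suc; +-comm; +-assoc; +-identityʳ; +-cancelʳ-≤; +-monoˡ-≤; +-commutativeSemigroup
        ; module ≤-Reasoning )
open import Algebra.Properties.CommutativeSemigroup +-commutativeSemigroup using (interchange)
open import Data.Product using (∃-syntax; _,_; proj₁; proj₂)
open import Data.Sum using (_⊎_; inj₁; inj₂; [_,_]′)
import Data.Sum as Sum
open import Function using (_∘_; id)
open import Function.Bundles using (Equivalence)
open import Relation.Binary.PropositionalEquality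
  using (_≢_; refl; sym; trans; cong; cong₂; subst; module ≡-Reasoning)
open import Relation.Nullary using (¬_)

open Equivalence using (to; from)

Box : ℕ → ℕ → Set
Box a b = Fin a × Fin b

_at_ : ∀ {a b} → Filling a b → Box a b → ℕ
W at (i , j) = W i j

data _⋖_ {a b : ℕ} : Box a b → Box a b → Set where
  right : ∀ {i j j′} → suc (toℕ j) ≡ toℕ j′ → (i , j) ⋖ (i , j′)
  below : ∀ {i i′ j} → suc (toℕ i) ≡ toℕ i′ → (i , j) ⋖ (i′ , j)

module _ {a b : ℕ} where

  adjacent⇒⋖ : (p q : Box a b) → T (adjacent p q) → p ⋖ q ⊎ q ⋖ p
  adjacent⇒⋖ (i , j) (i′ , j′) h with to T-∨ h
  ... | inj₁ h′ with to T-∧ h′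
  ...   | i≡i′ , step with toℕ-injective {i = i} {j = i′} (≡ᵇ⇒≡ _ _ i≡i′)
  ...     | refl =
    [ inj₁ ∘ right ∘ ≡ᵇ⇒≡ _ _ , inj₂ ∘ right ∘ ≡ᵇ⇒≡ _ _ ]′ (to T-∨ step)
  adjacent⇒⋖ (i , j) (i′ , j′) h | inj₂ h′ with to T-∧ h′
  ...   | j≡j′ , step with toℕ-injective {i = j} {j = j′} (≡ᵇ⇒≡ _ _ j≡j′)
  ...     | refl =
    [ inj₁ ∘ below ∘ ≡ᵇ⇒≡ _ _ , inj₂ ∘ below ∘ ≡ᵇ⇒≡ _ _ ]′ (to T-∨ step)

  ⋖⇒adjacent : {p q : Box a b} → p ⋖ q → T (adjacent p q) × T (adjacent q p)
  ⋖⇒adjacent (right {i} e) =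
    from T-∨ (inj₁ (from T-∧ (≡⇒≡ᵇ (toℕ i) _ refl , from T-∨ (inj₁ (≡⇒≡ᵇ _ _ e))))) ,
    from T-∨ (inj₁ (from T-∧ (≡⇒≡ᵇ (toℕ i) _ refl , from T-∨ (inj₂ (≡⇒≡ᵇ _ _ e)))))
  ⋖⇒adjacent (below {j = j} e) =
    from T-∨ (inj₂ (from T-∧ (≡⇒≡ᵇ (toℕ j) _ refl , from T-∨ (inj₁ (≡⇒≡ᵇ _ _ e))))) ,
    from T-∨ (inj₂ (from T-∧ (≡⇒≡ᵇ (toℕ j) _ refl , from T-∨ (inj₂ (≡⇒≡ᵇ _ _ e)))))

  adjacent-sym : (p q : Box a b) → T (adjacent p q) → T (adjacent q p)
  adjacent-sym p q = [ proj₂ ∘ ⋖⇒adjacent , proj₁ ∘ ⋖⇒adjacent ]′ ∘ adjacent⇒⋖ p q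

  ∈-boxes : (p : Box a b) → p ∈ boxes a b
  ∈-boxes (i , j) =
    ∈-concatMap⁺ (λ i → map (i ,_) (allFin b)) (lose (∈-allFin i) (∈-map⁺ (i ,_) (∈-allFin j)))

data Step (k w : ℕ) (c : Bool) (r : ℕ) : Set where
  fill      : w ≡ 1 → T c → r ≡ k → Step k w c r
  keep-hole : w ≡ 1 → ¬ T c → r ≡ 1 → Step k w c r
  vacate    : w ≡ k → T c → r ≡ 1 → Step k w c r
  keep-k    : w ≡ k → r ≡ k → Step k w c r
  other     : w ≢ 1 → w ≢ k → r ≡ w → Step k w c r

≡ᵇ-true⇒≡ : ∀ m n → (m ≡ᵇ n) ≡ true → m ≡ n
≡ᵇ-true⇒≡ m n = ≡ᵇ⇒≡ m n ∘ from T-≡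

≡ᵇ-false⇒≢ : ∀ m n → (m ≡ᵇ n) ≡ false → m ≢ n
≡ᵇ-false⇒≢ m n e = subst T e ∘ ≡⇒≡ᵇ m n

step-view : ∀ k w c → Step k w c (if in1k k w ∧ c then swap1k k w else w)
step-view k w c with w ≡ᵇ 1 in w≟1 | w ≡ᵇ k in w≟k | c
... | true  | _     | true  = fill (≡ᵇ-true⇒≡ w 1 w≟1) _ refl
... | true  | _     | false = keep-hole (≡ᵇ-true⇒≡ w 1 w≟1) id (≡ᵇ-true⇒≡ w 1 w≟1)
... | false | true  | true  = vacate (≡ᵇ-true⇒≡ w k w≟k) _ refl
... | false | true  | false = keep-k (≡ᵇ-true⇒≡ w k w≟k) (≡ᵇ-true⇒≡ w k w≟k)
... | false | false | _     = other (≡ᵇ-false⇒≢ w 1 w≟1) (≡ᵇ-false⇒≢ w k w≟k) refl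

data Status (n v w : ℕ) : Set where
  hole      : w ≡ 1 → v ≤ suc n → Status n v w
  unchanged : w ≡ v → Status n v w
  refilled  : v < w → w ≤ suc n → Status n v w

module _ {n v w : ℕ} where

  Status-hole : Status n v w → w ≡ 1 → v ≤ suc n
  Status-hole (hole _ v≤) _ = v≤
  Status-hole (unchanged refl) refl = s≤s z≤n
  Status-hole (refilled (s≤s z≤n) _) refl = z≤n

  Status-next : Status n v w → w ≡ 2 + n → v ≡ 2 + n
  Status-next (hole refl _) ()
  Status-next (unchanged refl) refl = refl
  Status-next (refilled _ w≤) refl = ⊥-elim (<-irrefl refl w≤)

  Status-hole-or-≥ : Status n v w → w ≡ 1 ⊎ v ≤ w
  Status-hole-or-≥ (hole w≡1 _) = inj₁ w≡1
  Status-hole-or-≥ (unchanged refl) = inj₂ ≤-refl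
  Status-hole-or-≥ (refilled v<w _) = inj₂ (<⇒≤ v<w)

  Status-unprocessed : Status n v w → suc n < v → w ≡ v
  Status-unprocessed (hole _ v≤) n<v = ⊥-elim (<⇒≱ n<v v≤)
  Status-unprocessed (unchanged w≡v) _ = w≡v
  Status-unprocessed (refilled v<w w≤) n<v = ⊥-elim (<⇒≱ n<v (<⇒≤ (<-≤-trans v<w w≤)))

Status-step : ∀ {n v w c r} → Status n v w → Step (2 + n) w c r → Status (suc n) v r
Status-step s (fill w≡1 _ refl) = refilled (s≤s (Status-hole s w≡1)) ≤-refl
Status-step s (keep-hole w≡1 _ r≡1) = hole r≡1 (m≤n⇒m≤1+n (Status-hole s w≡1))
Status-step s (vacate w≡k _ r≡1) = hole r≡1 (≤-reflexive (Status-next s w≡k))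
Status-step s (keep-k w≡k r≡k) = unchanged (trans r≡k (sym (Status-next s w≡k)))
Status-step (hole w≡1 _) (other w≢1 _ _) = ⊥-elim (w≢1 w≡1)
Status-step (unchanged w≡v) (other _ _ r≡w) = unchanged (trans r≡w w≡v)
Status-step (refilled v<w w≤) (other _ _ refl) = refilled v<w (m≤n⇒m≤1+n w≤)

Step-into-hole : ∀ {n w c r} → Step (2 + n) w c r → r ≡ 1 →
  (w ≡ 1 × ¬ T c) ⊎ (w ≡ 2 + n × T c)
Step-into-hole (fill _ _ refl) ()
Step-into-hole (keep-hole w≡1 ¬c _) _ = inj₁ (w≡1 , ¬c)
Step-into-hole (vacate w≡k c _) _ = inj₂ (w≡k , c)
Step-into-hole (keep-k _ refl) ()
Step-into-hole (other w≢1 _ refl) r≡1 = ⊥-elim (w≢1 r≡1)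

Step-hole-or-above : ∀ {n m w c r} → n ≤ m →
  w ≡ 1 ⊎ suc n < w → Step (2 + m) w c r → r ≡ 1 ⊎ suc n < r
Step-hole-or-above n≤m _ (fill _ _ refl) = inj₂ (s≤s (s≤s n≤m))
Step-hole-or-above _ _ (keep-hole _ _ r≡1) = inj₁ r≡1
Step-hole-or-above _ _ (vacate _ _ r≡1) = inj₁ r≡1
Step-hole-or-above n≤m _ (keep-k _ refl) = inj₂ (s≤s (s≤s n≤m))
Step-hole-or-above _ w (other _ _ refl) = w

Step-off-hole : ∀ {n w c r} → Step (2 + n) w c r → r ≢ 1 →
  (w ≡ 1 × T c × r ≡ 2 + n) ⊎ r ≡ w
Step-off-hole (fill w≡1 c r≡k) _ = inj₁ (w≡1 , c , r≡k)
Step-off-hole (keep-hole _ _ r≡1) r≢1 = ⊥-elim (r≢1 r≡1)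
Step-off-hole (vacate _ _ r≡1) r≢1 = ⊥-elim (r≢1 r≡1)
Step-off-hole (keep-k w≡k r≡k) _ = inj₂ (trans r≡k (sym w≡k))
Step-off-hole (other _ _ r≡w) _ = inj₂ r≡w

decr≡⇒ : ∀ ℓ w {v} → decr ℓ w ≡ v → (w ≤ 1 × v ≡ ℓ) ⊎ w ≡ suc v
decr≡⇒ ℓ zero e = inj₁ (z≤n , sym e)
decr≡⇒ ℓ (suc zero) e = inj₁ (s≤s z≤n , sym e)
decr≡⇒ ℓ (suc (suc w)) e = inj₂ (cong suc e)

module Promotion {a b : ℕ} (V : Filling a b)
                 (proper : ∀ p q → T (adjacent p q) → V at p ≢ V at q) where

  is-1k-neighbour : ℕ → Filling a b → Box a b → Box a b → Bool
  is-1k-neighbour k W p q = adjacent p q ∧ in1k k (W at q)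

  has-1k-neighbour : ℕ → Filling a b → Box a b → Bool
  has-1k-neighbour k W p = any (is-1k-neighbour k W p) (boxes a b)

  has-1k-neighbour⁻ : ∀ k W p → T (has-1k-neighbour k W p) →
    ∃[ q ] T (adjacent p q) × (W at q ≡ 1 ⊎ W at q ≡ k)
  has-1k-neighbour⁻ k W p h with satisfied (any⁻ (is-1k-neighbour k W p) (boxes a b) h)
  ... | q , h′ with to T-∧ h′
  ...   | adj , label = q , adj , Sum.map (≡ᵇ⇒≡ _ 1) (≡ᵇ⇒≡ _ k) (to T-∨ label)

  has-1k-neighbour⁺ : ∀ k W p {q} → T (adjacent p q) → W at q ≡ k → T (has-1k-neighbour k W p)
  has-1k-neighbour⁺ k W p {q} adj e =
    any⁺ (is-1k-neighbour k W p)
         (lose (∈-boxes q) (from T-∧ (adj , from (T-∨ {W at q ≡ᵇ 1}) (inj₂ (≡⇒≡ᵇ _ _ e)))))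

  stage : ℕ → Filling a b
  stage zero = V
  stage (suc n) = kstep (2 + n) (stage n)

  Kpromotion≡decr∘stage : ∀ ℓ i j → Kpromotion (suc ℓ) V i j ≡ decr (suc ℓ) (stage ℓ i j)
  Kpromotion≡decr∘stage ℓ i j =
    cong (λ W → decr (suc ℓ) (W i j)) (trans (foldl-map _ (2 +_) V (upTo ℓ)) (foldl≡stage ℓ))
    where
    steps : Filling a b → ℕ → Filling a b
    steps W n = kstep (2 + n) W

    foldl≡stage : ∀ m → foldl steps V (upTo m) ≡ stage m
    foldl≡stage zero = refl
    foldl≡stage (suc m) = begin
      foldl steps V (upTo (suc m))         ≡⟨ cong (foldl steps V) (sym (upTo-∷ʳ m)) ⟩
      foldl steps V (upTo m ∷ʳ m)          ≡⟨ foldl-∷ʳ steps V m (upTo m) ⟩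
      kstep (2 + m) (foldl steps V (upTo m)) ≡⟨ cong (kstep (2 + m)) (foldl≡stage m) ⟩
      stage (suc m)                        ∎
      where open ≡-Reasoning

  step-view-at : ∀ n p →
    Step (2 + n) (stage n at p) (has-1k-neighbour (2 + n) (stage n) p) (stage (suc n) at p)
  step-view-at n p = step-view (2 + n) _ _

  status : ∀ n p → Status n (V at p) (stage n at p)
  status zero p = unchanged refl
  status (suc n) p = Status-step (status n p) (step-view-at n p)

  hole⇒≤ : ∀ n p → stage n at p ≡ 1 → V at p ≤ suc n
  hole⇒≤ n p = Status-hole (status n p)

  next-label⇒original : ∀ n p → stage n at p ≡ 2 + n → V at p ≡ 2 + n
  next-label⇒original n p = Status-next (status n p)

  unprocessed⇒unchanged : ∀ n p → suc n < V at p → stage n at p ≡ V at p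
  unprocessed⇒unchanged n p = Status-unprocessed (status n p)

  no-adjacent-holes : ∀ n p q → T (adjacent p q) → stage n at p ≡ 1 → stage n at q ≡ 1 → ⊥
  no-adjacent-holes zero p q adj p≡1 q≡1 = proper p q adj (trans p≡1 (sym q≡1))
  no-adjacent-holes (suc n) p q adj p≡1 q≡1
    with Step-into-hole (step-view-at n p) p≡1 | Step-into-hole (step-view-at n q) q≡1
  ... | inj₁ (p-hole , _) | inj₁ (q-hole , _) = no-adjacent-holes n p q adj p-hole q-hole
  ... | inj₁ (_ , ¬p-swaps) | inj₂ (q-next , _) =
    ¬p-swaps (has-1k-neighbour⁺ (2 + n) (stage n) p adj q-next)
  ... | inj₂ (p-next , _) | inj₁ (_ , ¬q-swaps) =
    ¬q-swaps (has-1k-neighbour⁺ (2 + n) (stage n) q (adjacent-sym p q adj) p-next)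
  ... | inj₂ (p-next , _) | inj₂ (q-next , _) =
    proper p q adj (trans (next-label⇒original n p p-next) (sym (next-label⇒original n q q-next)))

  hole-origin : ∀ n p → V at p ≡ 2 + n → stage (suc n) at p ≡ 1 →
    ∃[ q ] T (adjacent p q) × stage n at q ≡ 1
  hole-origin n p V≡ p-hole with Step-into-hole (step-view-at n p) p-hole
  ... | inj₂ (_ , swaps) with has-1k-neighbour⁻ (2 + n) (stage n) p swaps
  ...   | q , adj , inj₁ q-hole = q , adj , q-hole
  ...   | q , adj , inj₂ q-next =
    ⊥-elim (proper p q adj (trans V≡ (sym (next-label⇒original n q q-next))))
  hole-origin n p V≡ p-hole | inj₁ (was-hole , _)
    with trans (sym was-hole) (trans (unprocessed⇒unchanged n p (≤-reflexive (sym V≡))) V≡)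
  ... | ()

  refill-origin : ∀ n p → stage n at p ≡ 1 → T (has-1k-neighbour (2 + n) (stage n) p) →
    ∃[ q ] T (adjacent p q) × V at q ≡ 2 + n
  refill-origin n p p-hole swaps with has-1k-neighbour⁻ (2 + n) (stage n) p swaps
  ... | q , adj , inj₁ q-hole = ⊥-elim (no-adjacent-holes n p q adj p-hole q-hole)
  ... | q , adj , inj₂ q-next = q , adj , next-label⇒original n q q-next

  changed⇒refilled : ∀ m p → stage m at p ≢ V at p → stage m at p ≢ 1 →
    ∃[ n ] stage m at p ≡ 2 + n × stage n at p ≡ 1 × T (has-1k-neighbour (2 + n) (stage n) p)
  changed⇒refilled zero p changed _ = ⊥-elim (changed refl)
  changed⇒refilled (suc m) p changed not-hole with Step-off-hole (step-view-at m p) not-hole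
  ... | inj₁ (p-hole , swaps , r≡k) = m , r≡k , p-hole , swaps
  ... | inj₂ r≡w with changed⇒refilled m p (changed ∘ trans r≡w) (not-hole ∘ trans r≡w)
  ...   | n , w≡ , earlier = n , trans r≡w w≡ , earlier

  hole⇒hole-or-above : ∀ {n m} p → n ≤′ m → stage n at p ≡ 1 →
    stage m at p ≡ 1 ⊎ suc n < stage m at p
  hole⇒hole-or-above p ≤′-refl p-hole = inj₁ p-hole
  hole⇒hole-or-above {m = suc m} p (≤′-step n≤m) p-hole =
    Step-hole-or-above (≤′⇒≤ n≤m) (hole⇒hole-or-above p n≤m p-hole) (step-view-at m p)

  Fixed : ℕ → Box a b → Set
  Fixed ℓ p = V at p ≡ Kpromotion ℓ V at p

  module _ {ℓ : ℕ} {p : Box a b} (fixed : Fixed (suc ℓ) p) where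

    private
      final : V at p ≡ decr (suc ℓ) (stage ℓ at p)
      final = trans fixed (Kpromotion≡decr∘stage ℓ (proj₁ p) (proj₂ p))

    fixed-final-label : V at p < suc ℓ → stage ℓ at p ≡ suc (V at p)
    fixed-final-label V<ℓ with decr≡⇒ (suc ℓ) (stage ℓ at p) (sym final)
    ... | inj₁ (_ , V≡ℓ) = ⊥-elim (<-irrefl V≡ℓ V<ℓ)
    ... | inj₂ w≡ = w≡

    fixed-history : 0 < V at p →
      (V at p ≡ suc ℓ × stage ℓ at p ≡ 1) ⊎
      (∃[ n ] V at p ≡ suc n × stage n at p ≡ 1 × T (has-1k-neighbour (2 + n) (stage n) p))
    fixed-history V>0 with decr≡⇒ (suc ℓ) (stage ℓ at p) (sym final)
    ... | inj₁ (w≤1 , V≡ℓ) = inj₁ (V≡ℓ , final-hole (Status-hole-or-≥ (status ℓ p)))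
      where
      final-hole : stage ℓ at p ≡ 1 ⊎ V at p ≤ stage ℓ at p → stage ℓ at p ≡ 1
      final-hole (inj₁ w≡1) = w≡1
      final-hole (inj₂ V≤w) = ≤-antisym w≤1 (≤-trans V>0 V≤w)
    ... | inj₂ w≡
      with changed⇒refilled ℓ p (1+n≢n ∘ trans (sym w≡)) (V≢0 ∘ suc-injective ∘ trans (sym w≡))
      where
      V≢0 : V at p ≢ 0
      V≢0 = >⇒≢ V>0
    ...   | n , w≡2+n , p-hole , swaps =
      inj₂ (n , suc-injective (trans (sym w≡) w≡2+n) , p-hole , swaps)

    fixed-hole-at-own-label : ∀ {m} → V at p ≡ suc m → stage m at p ≡ 1
    fixed-hole-at-own-label V≡ with fixed-history (subst (0 <_) (sym V≡) (s≤s z≤n))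
    ... | inj₁ (V≡ℓ , final-hole) =
      subst (λ k → stage k at p ≡ 1) (suc-injective (trans (sym V≡ℓ) V≡)) final-hole
    ... | inj₂ (n , V≡′ , p-hole , _) =
      subst (λ k → stage k at p ≡ 1) (suc-injective (trans (sym V≡′) V≡)) p-hole

    fixed-hole-only-at-own-label : ∀ {n} → V at p < suc ℓ → n ≤ ℓ →
      stage n at p ≡ 1 → V at p ≡ suc n
    fixed-hole-only-at-own-label {n} V<ℓ n≤ℓ p-hole
      with hole⇒hole-or-above p (≤⇒≤′ n≤ℓ) p-hole
    ... | inj₁ final-hole = ⊥-elim (<-irrefl (trans final (cong (decr (suc ℓ)) final-hole)) V<ℓ)
    ... | inj₂ n<w =
      ≤-antisym (hole⇒≤ n p p-hole) (s<s⁻¹ (subst (suc n <_) (fixed-final-label V<ℓ) n<w))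

    fixed⇒hole-neighbour : ∀ {n} → V at p ≡ 2 + n →
      ∃[ q ] T (adjacent p q) × stage n at q ≡ 1
    fixed⇒hole-neighbour {n} V≡ = hole-origin n p V≡ (fixed-hole-at-own-label V≡)

    fixed⇒successor-neighbour : 0 < V at p → V at p < suc ℓ →
      ∃[ q ] T (adjacent p q) × V at q ≡ suc (V at p)
    fixed⇒successor-neighbour V>0 V<ℓ with fixed-history V>0
    ... | inj₁ (V≡ℓ , _) = ⊥-elim (<-irrefl V≡ℓ V<ℓ)
    ... | inj₂ (n , V≡ , p-hole , swaps) with refill-origin n p p-hole swaps
    ...   | q , adj , Vq≡ = q , adj , trans Vq≡ (cong suc (sym V≡))

module _ {a b ℓ : ℕ} {V : Filling a b} (inc : IsIncreasing ℓ V) where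

  ⋖-increasing : ∀ {p q} → p ⋖ q → V at p < V at q
  ⋖-increasing (right {i} {j} {j′} e) = proj₁ (proj₂ inc) i j j′ (≤-reflexive e)
  ⋖-increasing (below {i} {i′} {j} e) = proj₂ (proj₂ inc) i i′ j (≤-reflexive e)

  increasing⇒proper : ∀ p q → T (adjacent p q) → V at p ≢ V at q
  increasing⇒proper p q adj =
    [ <⇒≢ ∘ ⋖-increasing , >⇒≢ ∘ ⋖-increasing ]′ (adjacent⇒⋖ p q adj)

  adjacent-<⇒⋖ : ∀ {p q} → T (adjacent p q) → V at q < V at p → q ⋖ p
  adjacent-<⇒⋖ {p} {q} adj Vq<Vp =
    [ (λ p⋖q → ⊥-elim (<-asym Vq<Vp (⋖-increasing p⋖q))) , id ]′ (adjacent⇒⋖ p q adj)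

  adjacent->⇒⋖ : ∀ {p q} → T (adjacent p q) → V at p < V at q → p ⋖ q
  adjacent->⇒⋖ {p} {q} adj Vp<Vq =
    [ id , (λ q⋖p → ⊥-elim (<-asym Vp<Vq (⋖-increasing q⋖p))) ]′ (adjacent⇒⋖ p q adj)

fromℕ-has-no-successor : ∀ n (k : Fin (suc n)) → suc (toℕ (fromℕ n)) ≢ toℕ k
fromℕ-has-no-successor n k e = <-irrefl (trans (sym e) (cong suc (toℕ-fromℕ n))) (toℕ<n k)

module _ {a b : ℕ} where

  ¬⋖-origin : ∀ {q : Box (suc a) (suc b)} → ¬ q ⋖ (zero , zero)
  ¬⋖-origin (right ())
  ¬⋖-origin (below ())

  ⋖-first-row : ∀ {q : Box (suc a) (suc b)} {j} → q ⋖ (zero , suc j) → q ≡ (zero , inject₁ j)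
  ⋖-first-row {j = j} (right e) =
    cong (zero ,_) (toℕ-injective (trans (suc-injective e) (sym (toℕ-inject₁ j))))

  last-column-⋖ : ∀ {q : Box (suc a) (suc b)} {i} →
    (inject₁ i , fromℕ b) ⋖ q → q ≡ (suc i , fromℕ b)
  last-column-⋖ (right e) = ⊥-elim (fromℕ-has-no-successor b _ e)
  last-column-⋖ {i = i} (below e) =
    cong (_, fromℕ b) (toℕ-injective (trans (sym e) (cong suc (toℕ-inject₁ i))))

  ¬corner-⋖ : ∀ {q : Box (suc a) (suc b)} → ¬ (fromℕ a , fromℕ b) ⋖ q
  ¬corner-⋖ (right e) = fromℕ-has-no-successor b _ e
  ¬corner-⋖ (below e) = fromℕ-has-no-successor a _ e

unit-steps⇒last : ∀ {n} (f : Fin (suc n) → ℕ) → (∀ j → f (suc j) ≡ suc (f (inject₁ j))) →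
  f (fromℕ n) ≡ n + f zero
unit-steps⇒last {zero} f _ = refl
unit-steps⇒last {suc n} f step = begin
  f (suc (fromℕ n))  ≡⟨ unit-steps⇒last (f ∘ suc) (step ∘ suc) ⟩
  n + f (suc zero)   ≡⟨ cong (n +_) (step zero) ⟩
  n + suc (f zero)   ≡⟨ +-suc n (f zero) ⟩
  suc n + f zero     ∎
  where open ≡-Reasoning

strictly-increasing-gap : ∀ {n} (f : Fin n → ℕ) → (∀ j k → toℕ j < toℕ k → f j < f k) →
  ∀ d {j k} → toℕ k ≡ toℕ j + d → f j + d ≤ f k
strictly-increasing-gap f mono zero {j} e =
  ≤-reflexive (trans (+-identityʳ (f j)) (cong f (toℕ-injective (sym (trans e (+-identityʳ (toℕ j)))))))
strictly-increasing-gap f mono (suc d) {j} {suc k} e = begin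
  f j + suc d          ≡⟨ +-suc (f j) d ⟩
  suc (f j + d)        ≤⟨ s≤s (strictly-increasing-gap f mono d inject₁k≡) ⟩
  suc (f (inject₁ k))  ≤⟨ mono (inject₁ k) (suc k) (s≤s (≤-reflexive (toℕ-inject₁ k))) ⟩
  f (suc k)            ∎
  where
  open ≤-Reasoning
  inject₁k≡ : toℕ (inject₁ k) ≡ toℕ j + d
  inject₁k≡ = trans (toℕ-inject₁ k) (suc-injective (trans e (+-suc (toℕ j) d)))
strictly-increasing-gap f mono (suc d) {j} {zero} e = ⊥-elim (0≢1+n (trans e (+-suc (toℕ j) d)))

squeeze : ∀ {u m n x y} → u + m ≤ x → x + n ≤ y → y ≡ u + (m + n) → x ≡ u + m
squeeze {u} {m} {n} {x} lower upper y≡ =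
  ≤-antisym (+-cancelʳ-≤ n x (u + m) (≤-trans upper (≤-reflexive (trans y≡ (sym (+-assoc u m n))))))
            lower

module _ {a b ℓ : ℕ} {V : Filling (suc a) (suc b)} (inc : IsIncreasing ℓ V) where

  private
    row-gap : ∀ i d {j k} → toℕ k ≡ toℕ j + d → V i j + d ≤ V i k
    row-gap i = strictly-increasing-gap (V i) (proj₁ (proj₂ inc) i)

    column-gap : ∀ j d {i k} → toℕ k ≡ toℕ i + d → V i j + d ≤ V k j
    column-gap j = strictly-increasing-gap (λ i → V i j) (λ i k → proj₂ (proj₂ inc) i k j)

  tight⇒minimal : V zero zero ≡ 1 → V (fromℕ a) (fromℕ b) ≡ suc (a + b) → IsMinimal V
  tight⇒minimal origin≡1 corner≡ i j
    with m≤n⇒∃[o]m+o≡n (s≤s⁻¹ (toℕ<n i)) | m≤n⇒∃[o]m+o≡n (s≤s⁻¹ (toℕ<n j))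
  ... | dI , I+dI≡a | dJ , J+dJ≡b = squeeze {u = 1} {m = toℕ i + toℕ j} lower upper corner-split
    where
    lower : 1 + (toℕ i + toℕ j) ≤ V i j
    lower = begin
      1 + (toℕ i + toℕ j)              ≡⟨ cong (_+ (toℕ i + toℕ j)) (sym origin≡1) ⟩
      V zero zero + (toℕ i + toℕ j)    ≡⟨ sym (+-assoc (V zero zero) (toℕ i) (toℕ j)) ⟩
      V zero zero + toℕ i + toℕ j      ≤⟨ +-monoˡ-≤ (toℕ j) (column-gap zero (toℕ i) refl) ⟩
      V i zero + toℕ j                 ≤⟨ row-gap i (toℕ j) refl ⟩
      V i j                            ∎
      where open ≤-Reasoning
    upper : V i j + (dI + dJ) ≤ V (fromℕ a) (fromℕ b)
    upper = begin
      V i j + (dI + dJ)  ≡⟨ sym (+-assoc (V i j) dI dJ) ⟩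
      V i j + dI + dJ    ≤⟨ +-monoˡ-≤ dJ (column-gap j dI (trans (toℕ-fromℕ a) (sym I+dI≡a))) ⟩
      V (fromℕ a) j + dJ ≤⟨ row-gap (fromℕ a) dJ (trans (toℕ-fromℕ b) (sym J+dJ≡b)) ⟩
      V (fromℕ a) (fromℕ b) ∎
      where open ≤-Reasoning
    corner-split : V (fromℕ a) (fromℕ b) ≡ 1 + ((toℕ i + toℕ j) + (dI + dJ))
    corner-split = begin
      V (fromℕ a) (fromℕ b)              ≡⟨ corner≡ ⟩
      suc (a + b)                        ≡⟨ cong suc (cong₂ _+_ (sym I+dI≡a) (sym J+dJ≡b)) ⟩
      suc ((toℕ i + dI) + (toℕ j + dJ))  ≡⟨ cong suc (interchange (toℕ i) dI (toℕ j) dJ) ⟩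
      suc ((toℕ i + toℕ j) + (dI + dJ))  ∎
      where open ≡-Reasoning

module Frame {a b ℓ : ℕ} (V : Filling (suc a) (suc b)) (inc : IsIncreasing (suc ℓ) V)
             (frame : SameFrame V (Kpromotion (suc ℓ) V)) where

  open Promotion V (increasing⇒proper inc)

  private
    label-pos : ∀ i j → 0 < V i j
    label-pos i j = proj₁ (proj₁ inc i j)

    label≤ℓ : ∀ i j → V i j ≤ suc ℓ
    label≤ℓ i j = proj₂ (proj₁ inc i j)

    first-row : ∀ j → Fixed (suc ℓ) (zero , j)
    first-row j = frame zero j (inj₁ (inj₁ refl))

    last-column : ∀ i → Fixed (suc ℓ) (i , fromℕ b)
    last-column i = frame i (fromℕ b) (inj₂ (inj₂ (cong suc (toℕ-fromℕ b))))

    hole-predecessor : ∀ {p n} → Fixed (suc ℓ) p → V at p ≡ 2 + n →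
      ∃[ q ] q ⋖ p × stage n at q ≡ 1
    hole-predecessor {n = n} fixed V≡ with fixed⇒hole-neighbour fixed V≡
    ... | q , adj , q-hole =
      q , adjacent-<⇒⋖ inc adj (subst (V at q <_) (sym V≡) (s≤s (hole⇒≤ n q q-hole))) , q-hole

    successor : ∀ {p} → Fixed (suc ℓ) p → V at p < suc ℓ →
      ∃[ q ] p ⋖ q × V at q ≡ suc (V at p)
    successor {p} fixed V<ℓ with fixed⇒successor-neighbour fixed (label-pos (proj₁ p) (proj₂ p)) V<ℓ
    ... | q , adj , Vq≡ = q , adjacent->⇒⋖ inc adj (≤-reflexive (sym Vq≡)) , Vq≡

  origin≡1 : V zero zero ≡ 1
  origin≡1 with m≤n⇒∃[o]m+o≡n (label-pos zero zero)
  ... | zero , e = sym e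
  ... | suc n , e = ⊥-elim (¬⋖-origin (proj₁ (proj₂ (hole-predecessor (first-row zero) (sym e)))))

  first-row-step : ∀ (j : Fin b) → V zero (suc j) ≡ suc (V zero (inject₁ j))
  first-row-step j with m≤n⇒∃[o]m+o≡n 2≤V
    where
    2≤V : 2 ≤ V zero (suc j)
    2≤V = <-≤-trans (s≤s (label-pos zero zero)) (proj₁ (proj₂ inc) zero zero (suc j) (s≤s z≤n))
  ... | n , e with hole-predecessor (first-row (suc j)) (sym e)
  ...   | q , q⋖p , q-hole with ⋖-first-row q⋖p
  ...     | refl = trans (sym e) (cong suc (sym Vq≡))
    where
    Vq<ℓ : V zero (inject₁ j) < suc ℓ
    Vq<ℓ = <-≤-trans (⋖-increasing inc q⋖p) (label≤ℓ zero (suc j))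
    n≤ℓ : n ≤ ℓ
    n≤ℓ = ≤-trans (n≤1+n n) (s≤s⁻¹ (subst (_≤ suc ℓ) (sym e) (label≤ℓ zero (suc j))))
    Vq≡ : V zero (inject₁ j) ≡ suc n
    Vq≡ = fixed-hole-only-at-own-label (first-row (inject₁ j)) Vq<ℓ n≤ℓ q-hole

  last-column-step : ∀ (i : Fin a) → V (suc i) (fromℕ b) ≡ suc (V (inject₁ i) (fromℕ b))
  last-column-step i with successor (last-column (inject₁ i)) Vp<ℓ
    where
    Vp<ℓ : V (inject₁ i) (fromℕ b) < suc ℓ
    Vp<ℓ = <-≤-trans (⋖-increasing inc (below (cong suc (toℕ-inject₁ i))))
                     (label≤ℓ (suc i) (fromℕ b))
  ... | q , p⋖q , Vq≡ with last-column-⋖ p⋖q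
  ...   | refl = Vq≡

  corner≡ℓ : V (fromℕ a) (fromℕ b) ≡ suc ℓ
  corner≡ℓ with m≤n⇒m<n∨m≡n (label≤ℓ (fromℕ a) (fromℕ b))
  ... | inj₂ V≡ℓ = V≡ℓ
  ... | inj₁ V<ℓ = ⊥-elim (¬corner-⋖ (proj₁ (proj₂ (successor (last-column (fromℕ a)) V<ℓ))))

proposition3p2 : (a b ℓ : ℕ) → 1 ≤ a → 1 ≤ b → 1 ≤ ℓ →
    (V : Filling a b) → IsIncreasing ℓ V →
    SameFrame V (Kpromotion ℓ V) →
    IsMinimal V × ℓ ≡ a + b ∸ 1
proposition3p2 (suc a) (suc b) (suc ℓ) _ _ _ V inc frame =
  tight⇒minimal inc origin≡1 (trans corner≡ (+-suc a b)) , trans (sym corner≡ℓ) corner≡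
  where
  open Frame V inc frame
  open ≡-Reasoning
  corner≡ : V (fromℕ a) (fromℕ b) ≡ a + suc b
  corner≡ = begin
    V (fromℕ a) (fromℕ b)  ≡⟨ unit-steps⇒last (λ i → V i (fromℕ b)) last-column-step ⟩
    a + V zero (fromℕ b)   ≡⟨ cong (a +_) (unit-steps⇒last (V zero) first-row-step) ⟩
    a + (b + V zero zero)  ≡⟨ cong (λ v → a + (b + v)) origin≡1 ⟩
    a + (b + 1)            ≡⟨ cong (a +_) (+-comm b 1) ⟩
    a + suc b              ∎
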